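{- Let $\eta,\delta,M>1$ and $f\ge 1$ be integers with $\gcd(\eta,\delta)=1$ (so $\mu=\eta/\delta$ is an irreducible fraction). Assume that $M$ is the number of terms of a sum of consecutive squared integers equal to a squared integer, i.e. there exist integers $a\ge 1$ and $s$ with $\sum_{i=0}^{M-1}(a+i)^2=s^2$. Suppose $$(\delta f)^2-M(\eta+\delta)^2=\delta^2\,\frac{M+1}{3},$$ equivalently $M=\dfrac{\delta^2(3f^2-1)}{3(\eta+\delta)^2+\delta^2}$. Then $\eta\equiv 1 \pmod 2$ and $\delta\equiv 0,1$ or $5 \pmod 6$; moreover, if $\delta\equiv 0\pmod 6$ then $M\equiv 0\pmod{12}$, and if $\delta\equiv 1$ or $5\pmod 6$ then $M\equiv 2\pmod{12}$ when $f$ is odd and $M\equiv 11\pmod{12}$ when $f$ is even. More precisely, $\eta,\delta,f,M$ satisfy one of the following: (a) $\delta\equiv 0\pmod{36}$, $\eta\equiv 1$ or $5\pmod 6$, $f$ arbitrary, $M\equiv 0\pmod{144}$; (b) $\delta\equiv 12$ or $24\pmod{36}$, $\eta\equiv 1$ or $5\pmod 6$, $f$ arbitrary, $M\equiv 96\pmod{144}$; (c) $\delta\equiv 6$ or $30\pmod{36}$, $\eta\equiv 1$ or $5\pmod 6$, $f\equiv 1\pmod 2$, $M\equiv 24\pmod{144}$; (d) $\delta\equiv 18\pmod{36}$, $\eta\equiv 1$ or $5\pmod 6$, $f\equiv 1\pmod 2$, $M\equiv 72\pmod{144}$; (e) $\delta\equiv 1\pmod 6$: if $f\equiv 1$ or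 $5\pmod 6$ then $M\equiv 50\pmod{72}$ when $\eta\equiv 1$ or $3\pmod 6$ and $M\equiv 2\pmod{72}$ when $\eta\equiv 5\pmod 6$; if $f\equiv 3\pmod 6$ then $M\equiv 2\pmod{72}$ when $\eta\equiv 1$ or $3\pmod 6$ and $M\equiv 26\pmod{72}$ when $\eta\equiv 5\pmod 6$; if $f\equiv 0\pmod 6$ then $M\equiv 11\pmod{36}$ when $\eta\equiv 1$ or $3\pmod 6$ and $M\equiv 35\pmod{36}$ when $\eta\equiv 5\pmod 6$; if $f\equiv 2$ or $4\pmod 6$ then $M\equiv 23\pmod{36}$ when $\eta\equiv 1$ or $3\pmod 6$ and $M\equiv 11\pmod{36}$ when $\eta\equiv 5\pmod 6$; (f) $\delta\equiv 5\pmod 6$: if $f\equiv 1$ or $5\pmod 6$ then $M\equiv 2\pmod{72}$ when $\eta\equiv 1\pmod 6$ and $M\equiv 50\pmod{72}$ when $\eta\equiv 3$ or $5\pmod 6$; if $f\equiv 3\pmod 6$ then $M\equiv 26\pmod{72}$ when $\eta\equiv 1\pmod 6$ and $M\equiv 2\pmod{72}$ when $\eta\equiv 3$ or $5\pmod 6$; if $f\equiv 0\pmod 6$ then $M\equiv 35\pmod{36}$ when $\eta\equiv 1\pmod 6$ and $M\equiv 11\pmod{36}$ when $\eta\equiv 3$ or $5\pmod 6$; if $f\equiv 2$ or $4\pmod 6$ then $M\equiv 11\pmod{36}$ when $\eta\equiv 1\pmod 6$ and $M\equiv 23\pmod{36}$ when $\eta\equiv 3$ or $5\pmod 6$.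
   Context: Setting of the paper: for a positive rational $\mu=\eta/\delta$ in lowest terms, two positive integers $a_1,a_2$ form a pair for a common number of terms $M$ if $a_1+a_2=\mu M+1$ and $a_2-a_1=f$; when $M=\delta^2(3f^2-1)/(3(\eta+\delta)^2+\delta^2)$, the sums $\sum_{i=0}^{M-1}(a_j+i)^2$ ($j=1,2$) are perfect squares. In this setting $M$ is the number of terms of a sum of $M$ consecutive squares equal to a square, and $f$ is the difference $a_2-a_1$ (so $f$ odd means $a_1,a_2$ have different parities). -}

module Defs where

open import Data.Nat using (ℕ; zero; suc; _+_; _*_; _^_)

sumSq : ℕ → ℕ → ℕ
sumSq a zero = 0
sumSq a (suc m) = sumSq a m + (a + m) ^ 2

-- The equation makes c = 3(η+δ)² + δ² divide (3(η+δ)f)² + δ², and, when δ = 3d, makes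
-- w = (η+3d)² + 3d² divide 3(((η+3d)f)² + d²).  A modulus ≡ 3 (mod 4) never divides x² + y²
-- with y prime to it, because −1 is not a square modulo such a number (a descent on the modulus);
-- so δ is even exactly when 3 ∣ δ.  Reading the equation modulo 16 and modulo 9 (after dividing
-- by 3 when 3 ∣ δ), and the closed form of a sum of M consecutive squares modulo 8 (M ≢ 4),
-- gives the 2-adic and 3-adic constraints.  Every assertion of the theorem is a statement about the
-- residues of η, δ, f, M modulo 6, 36, 6, 144 that follows from these constraints; this is checked
-- by evaluating both over all residues, via a small language of modular formulas whose truth
-- only depends on the residues of the variables.
module Submission where

open import Defs
open import Data.Bool.Base using (Bool; true; false; T; _∧_; _∨_; not)
open import Data.Bool.Properties using (T-∧)
open import Data.Empty using (⊥-elim)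
open import Data.Fin.Base using (Fin; zero; suc)
open import Data.Nat.Base
open import Data.Nat.Coprimality using (Coprime; coprime-Bézout; coprime-divisor; gcd≡1⇒coprime)
open import Data.Nat.DivMod
  using (m≡m%n+[m/n]*n; [m+kn]%n≡m%n; %-distribˡ-+; %-distribˡ-*; m%n<n; m%n≤m; m%n≤n; m∣n⇒o%n%m≡o%m)
open import Data.Nat.Divisibility
open import Data.Nat.GCD using (gcd; module Bézout)
open import Data.Nat.Induction using (<-rec)
open import Data.Nat.Primality using (Irreducible; irreducible?)
open import Data.Nat.Properties
open import Data.Nat.Tactic.RingSolver using (solve-∀)
open import Data.Product.Base using (∃-syntax; _×_; _,_; proj₁; proj₂)
open import Data.Sum.Base using (_⊎_; inj₁; inj₂)
open import Data.Unit.Base using (⊤)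
open import Data.Vec.Base using (Vec; []; _∷_; lookup; zipWith)
open import Data.Vec.Properties using (lookup-zipWith)
open import Function.Base using (id; _∘_)
open import Function.Bundles using (Equivalence)
open import Relation.Binary.PropositionalEquality
open import Relation.Nullary.Decidable
open import Relation.Nullary.Negation using (¬_; contradiction)

private
  variable
    n m : ℕ

-- Modular formulas, decided by enumerating residues

%-cong-+ : ∀ {m a a′ b b′} .{{_ : NonZero m}} →
           a % m ≡ a′ % m → b % m ≡ b′ % m → (a + b) % m ≡ (a′ + b′) % m
%-cong-+ {m} {a} {a′} {b} {b′} a≡a′ b≡b′ = begin
  (a + b) % m            ≡⟨ %-distribˡ-+ a b m ⟩
  (a % m + b % m) % m    ≡⟨ cong₂ (λ x y → (x + y) % m) a≡a′ b≡b′ ⟩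
  (a′ % m + b′ % m) % m  ≡⟨ %-distribˡ-+ a′ b′ m ⟨
  (a′ + b′) % m          ∎
  where open ≡-Reasoning

%-cong-* : ∀ {m a a′ b b′} .{{_ : NonZero m}} →
           a % m ≡ a′ % m → b % m ≡ b′ % m → (a * b) % m ≡ (a′ * b′) % m
%-cong-* {m} {a} {a′} {b} {b′} a≡a′ b≡b′ = begin
  (a * b) % m              ≡⟨ %-distribˡ-* a b m ⟩
  (a % m * (b % m)) % m    ≡⟨ cong₂ (λ x y → (x * y) % m) a≡a′ b≡b′ ⟩
  (a′ % m * (b′ % m)) % m  ≡⟨ %-distribˡ-* a′ b′ m ⟨
  (a′ * b′) % m            ∎
  where open ≡-Reasoning

%-cong-^ : ∀ {m a a′} .{{_ : NonZero m}} → a % m ≡ a′ % m → ∀ k → a ^ k % m ≡ a′ ^ k % m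
%-cong-^ a≡a′ zero    = refl
%-cong-^ a≡a′ (suc k) = %-cong-* a≡a′ (%-cong-^ a≡a′ k)

infixl 6 _:+_
infixl 7 _:*_
infixr 8 _:^_

data Expr (n : ℕ) : Set where
  var  : Fin n → Expr n
  con  : ℕ → Expr n
  _:+_ : Expr n → Expr n → Expr n
  _:*_ : Expr n → Expr n → Expr n
  _:^_ : Expr n → ℕ → Expr n

⟦_⟧ : Expr n → Vec ℕ n → ℕ
⟦ var i ⟧  ρ = lookup ρ i
⟦ con k ⟧  ρ = k
⟦ a :+ b ⟧ ρ = ⟦ a ⟧ ρ + ⟦ b ⟧ ρ
⟦ a :* b ⟧ ρ = ⟦ a ⟧ ρ * ⟦ b ⟧ ρ
⟦ a :^ k ⟧ ρ = ⟦ a ⟧ ρ ^ k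

infix  4 _≡_mod_
infix  5 :¬_
infixr 3 _:∧_
infixr 2 _:∨_
infixr 1 _:⇒_

data Formula (n : ℕ) : Set where
  _≡_mod_        : Expr n → Expr n → (m : ℕ) .{{_ : NonZero m}} → Formula n
  _:∧_ _:∨_ _:⇒_ : Formula n → Formula n → Formula n
  :¬_            : Formula n → Formula n

Holds : Formula n → Vec ℕ n → Set
Holds (a ≡ b mod m) ρ = ⟦ a ⟧ ρ % m ≡ ⟦ b ⟧ ρ % m
Holds (φ :∧ ψ)      ρ = Holds φ ρ × Holds ψ ρ
Holds (φ :∨ ψ)      ρ = Holds φ ρ ⊎ Holds ψ ρ
Holds (φ :⇒ ψ)      ρ = Holds φ ρ → Holds ψ ρ
Holds (:¬ φ)        ρ = ¬ Holds φ ρ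

holds? : (φ : Formula n) (ρ : Vec ℕ n) → Dec (Holds φ ρ)
holds? (a ≡ b mod m) ρ = ⟦ a ⟧ ρ % m ≟ ⟦ b ⟧ ρ % m
holds? (φ :∧ ψ)      ρ = holds? φ ρ ×-dec holds? ψ ρ
holds? (φ :∨ ψ)      ρ = holds? φ ρ ⊎-dec holds? ψ ρ
holds? (φ :⇒ ψ)      ρ = holds? φ ρ →-dec holds? ψ ρ
holds? (:¬ φ)        ρ = ¬? (holds? φ ρ)

-- The boolean part of holds?, stated on its own because the type checker evaluates it twice as fast.
holdsᵇ : Formula n → Vec ℕ n → Bool
holdsᵇ (a ≡ b mod m) ρ = ⟦ a ⟧ ρ % m ≡ᵇ ⟦ b ⟧ ρ % m
holdsᵇ (φ :∧ ψ)      ρ = holdsᵇ φ ρ ∧ holdsᵇ ψ ρ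
holdsᵇ (φ :∨ ψ)      ρ = holdsᵇ φ ρ ∨ holdsᵇ ψ ρ
holdsᵇ (φ :⇒ ψ)      ρ = not (holdsᵇ φ ρ) ∨ holdsᵇ ψ ρ
holdsᵇ (:¬ φ)        ρ = not (holdsᵇ φ ρ)

holdsᵇ≡does : (φ : Formula n) (ρ : Vec ℕ n) → holdsᵇ φ ρ ≡ does (holds? φ ρ)
holdsᵇ≡does (a ≡ b mod m) ρ = refl
holdsᵇ≡does (φ :∧ ψ)      ρ = cong₂ _∧_ (holdsᵇ≡does φ ρ) (holdsᵇ≡does ψ ρ)
holdsᵇ≡does (φ :∨ ψ)      ρ = cong₂ _∨_ (holdsᵇ≡does φ ρ) (holdsᵇ≡does ψ ρ)
holdsᵇ≡does (φ :⇒ ψ)      ρ = cong₂ (λ x y → not x ∨ y) (holdsᵇ≡does φ ρ) (holdsᵇ≡does ψ ρ)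
holdsᵇ≡does (:¬ φ)        ρ = cong not (holdsᵇ≡does φ ρ)

holdsᵇ-sound : (φ : Formula n) (ρ : Vec ℕ n) → T (holdsᵇ φ ρ) → Holds φ ρ
holdsᵇ-sound φ ρ h with holds? φ ρ | holdsᵇ≡does φ ρ
... | yes p | _  = p
... | no _  | eq = ⊥-elim (subst T eq h)

-- Under this condition the truth of a formula only depends on the residues of its variables modulo N.
CompatibleExpr : Vec ℕ n → ℕ → Expr n → Set
CompatibleExpr N m (var i)  = True (m ∣? lookup N i)
CompatibleExpr N m (con _)  = ⊤
CompatibleExpr N m (a :+ b) = CompatibleExpr N m a × CompatibleExpr N m b
CompatibleExpr N m (a :* b) = CompatibleExpr N m a × CompatibleExpr N m b
CompatibleExpr N m (a :^ _) = CompatibleExpr N m a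

Compatible : Vec ℕ n → Formula n → Set
Compatible N (a ≡ b mod m) = CompatibleExpr N m a × CompatibleExpr N m b
Compatible N (φ :∧ ψ)      = Compatible N φ × Compatible N ψ
Compatible N (φ :∨ ψ)      = Compatible N φ × Compatible N ψ
Compatible N (φ :⇒ ψ)      = Compatible N φ × Compatible N ψ
Compatible N (:¬ φ)        = Compatible N φ

-- Unlike _%_ this is total: reduction modulo 0 leaves x unchanged.
_%₀_ : ℕ → ℕ → ℕ
x %₀ zero      = x
x %₀ m@(suc _) = x % m

m∣n⇒o%₀n%m≡o%m : ∀ x k m .{{_ : NonZero m}} → m ∣ k → x %₀ k % m ≡ x % m
m∣n⇒o%₀n%m≡o%m x zero      m _   = refl
m∣n⇒o%₀n%m≡o%m x k@(suc _) m m∣k = m∣n⇒o%n%m≡o%m m k x m∣k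

reduce : Vec ℕ n → Vec ℕ n → Vec ℕ n
reduce N ρ = zipWith _%₀_ ρ N

⟦⟧-reduce : ∀ {N ρ} (e : Expr n) .{{_ : NonZero m}} → CompatibleExpr N m e →
            ⟦ e ⟧ (reduce N ρ) % m ≡ ⟦ e ⟧ ρ % m
⟦⟧-reduce {m = m} {N} {ρ} (var i) c = begin
  lookup (zipWith _%₀_ ρ N) i % m  ≡⟨ cong (_% m) (lookup-zipWith _%₀_ i ρ N) ⟩
  lookup ρ i %₀ lookup N i % m     ≡⟨ m∣n⇒o%₀n%m≡o%m (lookup ρ i) (lookup N i) m (toWitness c) ⟩
  lookup ρ i % m                   ∎
  where open ≡-Reasoning
⟦⟧-reduce (con k)  c         = refl
⟦⟧-reduce (a :+ b) (ca , cb) = %-cong-+ (⟦⟧-reduce a ca) (⟦⟧-reduce b cb)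
⟦⟧-reduce (a :* b) (ca , cb) = %-cong-* (⟦⟧-reduce a ca) (⟦⟧-reduce b cb)
⟦⟧-reduce (a :^ k) c         = %-cong-^ (⟦⟧-reduce a c) k

Holds-reduce : ∀ {N ρ} (φ : Formula n) → Compatible N φ → Holds φ (reduce N ρ) ≡ Holds φ ρ
Holds-reduce (a ≡ b mod m) (ca , cb) = cong₂ _≡_ (⟦⟧-reduce a ca) (⟦⟧-reduce b cb)
Holds-reduce (φ :∧ ψ)      (cφ , cψ) = cong₂ _×_ (Holds-reduce φ cφ) (Holds-reduce ψ cψ)
Holds-reduce (φ :∨ ψ)      (cφ , cψ) = cong₂ _⊎_ (Holds-reduce φ cφ) (Holds-reduce ψ cψ)
Holds-reduce (φ :⇒ ψ)      (cφ , cψ) = cong₂ (λ A B → A → B) (Holds-reduce φ cφ) (Holds-reduce ψ cψ)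
Holds-reduce (:¬ φ)        cφ        = cong ¬_ (Holds-reduce φ cφ)

every : ℕ → (ℕ → Bool) → Bool
every zero    p = true
every (suc m) p = p m ∧ every m p

every-sound : ∀ {r} m (p : ℕ → Bool) → T (every m p) → r < m → T (p r)
every-sound {r} (suc m) p h r<1+m with Equivalence.to T-∧ h | r ≟ m
... | pm , _    | yes refl = pm
... | _ , rest  | no r≢m   = every-sound m p rest (≤∧≢⇒< (≤-pred r<1+m) r≢m)

-- A zero modulus makes the enumeration fail rather than succeed vacuously.
allBelow : Vec ℕ n → (Vec ℕ n → Bool) → Bool
allBelow []              p = p []
allBelow (zero ∷ N)      p = false
allBelow (m@(suc _) ∷ N) p = every m λ r → allBelow N λ ρ → p (r ∷ ρ)

allBelow-sound : ∀ (N : Vec ℕ n) p → T (allBelow N p) → ∀ ρ → T (p (reduce N ρ))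
allBelow-sound []              p h []      = h
allBelow-sound (m@(suc _) ∷ N) p h (x ∷ ρ) =
  allBelow-sound N _ (every-sound m _ h (m%n<n x m)) ρ

holds-by-residues : (N : Vec ℕ n) (φ : Formula n) {_ : Compatible N φ} {_ : T (allBelow N (holdsᵇ φ))} →
                    ∀ ρ → Holds φ ρ
holds-by-residues N φ {compatible} {checked} ρ =
  subst id (Holds-reduce φ compatible)
    (holdsᵇ-sound φ (reduce N ρ) (allBelow-sound N (holdsᵇ φ) checked ρ))

-- Sums of consecutive squares

m^2≡m*m : ∀ m → m ^ 2 ≡ m * m
m^2≡m*m m = cong (m *_) (*-identityʳ m)

sumSq-closed : ∀ a n → 6 * sumSq a n + 3 * (n * n) + 6 * a * n
                     ≡ n * (6 * (a * a) + 6 * a * n + 2 * (n * n) + 1)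
sumSq-closed a zero    = *-zeroʳ (6 * a)
sumSq-closed a (suc n) = begin
  6 * (sumSq a n + (a + n) ^ 2) + 3 * (suc n * suc n) + 6 * a * suc n
    ≡⟨ cong (λ t → 6 * (sumSq a n + t) + 3 * (suc n * suc n) + 6 * a * suc n) (m^2≡m*m (a + n)) ⟩
  6 * (sumSq a n + (a + n) * (a + n)) + 3 * (suc n * suc n) + 6 * a * suc n
    ≡⟨ regroup (sumSq a n) a n ⟩
  (6 * sumSq a n + 3 * (n * n) + 6 * a * n) + 3 * (2 * (a + n) * (a + n) + 2 * n + 1 + 2 * a)
    ≡⟨ cong (_+ 3 * (2 * (a + n) * (a + n) + 2 * n + 1 + 2 * a)) (sumSq-closed a n) ⟩
  n * (6 * (a * a) + 6 * a * n + 2 * (n * n) + 1) + 3 * (2 * (a + n) * (a + n) + 2 * n + 1 + 2 * a)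
    ≡⟨ expand a n ⟩
  suc n * (6 * (a * a) + 6 * a * suc n + 2 * (suc n * suc n) + 1) ∎
  where
  open ≡-Reasoning
  regroup : ∀ S a n → 6 * (S + (a + n) * (a + n)) + 3 * ((1 + n) * (1 + n)) + 6 * a * (1 + n)
          ≡ (6 * S + 3 * (n * n) + 6 * a * n) + 3 * (2 * (a + n) * (a + n) + 2 * n + 1 + 2 * a)
  regroup = solve-∀
  expand : ∀ a n → n * (6 * (a * a) + 6 * a * n + 2 * (n * n) + 1)
                   + 3 * (2 * (a + n) * (a + n) + 2 * n + 1 + 2 * a)
         ≡ (1 + n) * (6 * (a * a) + 6 * a * (1 + n) + 2 * ((1 + n) * (1 + n)) + 1)
  expand = solve-∀

sumSq≡square⇒%8≢4 : ∀ {a n s} → sumSq a n ≡ s ^ 2 → ¬ n % 8 ≡ 4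
sumSq≡square⇒%8≢4 {a} {n} {s} sq =
  holds-by-residues (8 ∷ 8 ∷ 8 ∷ []) (closed-form-mod-8 :⇒ :¬ (vn ≡ con 4 mod 8)) (a ∷ n ∷ s ∷ [])
    (cong (_% 8) (begin
      6 * (s * s) + 3 * (n * n) + 6 * a * n    ≡⟨ cong (λ t → 6 * t + 3 * (n * n) + 6 * a * n) s*s≡sumSq ⟩
      6 * sumSq a n + 3 * (n * n) + 6 * a * n  ≡⟨ sumSq-closed a n ⟩
      n * (6 * (a * a) + 6 * a * n + 2 * (n * n) + 1) ∎))
  where
  open ≡-Reasoning
  s*s≡sumSq : s * s ≡ sumSq a n
  s*s≡sumSq = trans (sym (m^2≡m*m s)) (sym sq)
  va vn vs : Expr 3
  va = var zero
  vn = var (suc zero)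
  vs = var (suc (suc zero))
  closed-form-mod-8 : Formula 3
  closed-form-mod-8 = con 6 :* (vs :* vs) :+ con 3 :* (vn :* vn) :+ con 6 :* va :* vn
                    ≡ vn :* (con 6 :* (va :* va) :+ con 6 :* va :* vn :+ con 2 :* (vn :* vn) :+ con 1) mod 8

-- Moduli ≡ 3 (mod 4) and sums of two squares

square+1-% : ∀ {c} z .{{_ : NonZero c}} → c ∣ z * z + 1 → c ∣ (z % c) * (z % c) + 1
square+1-% {c} z c∣ = ∣m+n∣m⇒∣n (subst (c ∣_) (expand r q c) c∣′) (n∣m*n (q * (2 * r + q * c)))
  where
  r q : ℕ
  r = z % c
  q = z / c
  c∣′ : c ∣ (r + q * c) * (r + q * c) + 1
  c∣′ = subst (λ t → c ∣ t * t + 1) (m≡m%n+[m/n]*n z c) c∣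
  expand : ∀ r q c → (r + q * c) * (r + q * c) + 1 ≡ q * (2 * r + q * c) * c + (r * r + 1)
  expand = solve-∀

square+1-mirror : ∀ {c} w r → w + r ≡ c → c ∣ r * r + 1 → c ∣ w * w + 1
square+1-mirror {c} w r refl c∣ =
  ∣m+n∣m⇒∣n (subst (c ∣_) (sym (expand w r)) (∣m∣n⇒∣m+n c∣ (n∣m*n c))) (n∣m*n (2 * r))
  where
  expand : ∀ w r → 2 * r * (w + r) + (w * w + 1) ≡ r * r + 1 + (w + r) * (w + r)
  expand = solve-∀

square+1-small-root : ∀ {c} z .{{_ : NonZero c}} → c ∣ z * z + 1 →
                      ∃[ w ] (2 * w ≤ c × c ∣ w * w + 1)
square+1-small-root {c} z c∣ with 2 * (z % c) ≤? c
... | yes 2r≤c = z % c , 2r≤c , square+1-% z c∣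
... | no  2r≰c = w , 2w≤c , square+1-mirror w r w+r≡c (square+1-% z c∣)
  where
  r w : ℕ
  r = z % c
  w = c ∸ r
  w+r≡c : w + r ≡ c
  w+r≡c = m∸n+n≡m (m%n≤n z c)
  2w≤c : 2 * w ≤ c
  2w≤c = ≮⇒≥ λ c<2w → <-irrefl (sym 2w+2r≡c+c) (+-mono-< c<2w (≰⇒> 2r≰c))
    where
    2w+2r≡c+c : 2 * w + 2 * r ≡ c + c
    2w+2r≡c+c = begin
      2 * w + 2 * r ≡⟨ *-distribˡ-+ 2 w r ⟨
      2 * (w + r)   ≡⟨ cong (2 *_) w+r≡c ⟩
      c + (c + 0)   ≡⟨ cong (c +_) (+-identityʳ c) ⟩
      c + c         ∎
      where open ≡-Reasoning

cofactor-< : ∀ {c e} w → 2 ≤ c → 2 * w ≤ c → w * w + 1 ≡ e * c → e < c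
cofactor-< {c} {e} w 2≤c 2w≤c eq = ≰⇒> c≰e
  where
  c≰e : ¬ c ≤ e
  c≰e c≤e = <-irrefl refl (begin-strict
    4 * (c * c)          ≤⟨ *-monoʳ-≤ 4 (*-monoˡ-≤ c c≤e) ⟩
    4 * (e * c)          ≡⟨ cong (4 *_) eq ⟨
    4 * (w * w + 1)      ≡⟨ quadruple w ⟩
    2 * w * (2 * w) + 4  ≤⟨ +-monoˡ-≤ 4 (*-mono-≤ 2w≤c 2w≤c) ⟩
    c * c + 4            <⟨ +-monoʳ-< (c * c) (≤-trans (m≤m+n 5 7) (*-monoʳ-≤ 3 2*2≤c*c)) ⟩
    c * c + 3 * (c * c)  ≡⟨ quadruple′ (c * c) ⟩
    4 * (c * c)          ∎)
    where
    open ≤-Reasoning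
    quadruple : ∀ w → 4 * (w * w + 1) ≡ 2 * w * (2 * w) + 4
    quadruple = solve-∀
    quadruple′ : ∀ x → x + 3 * x ≡ 4 * x
    quadruple′ = solve-∀
    2*2≤c*c : 2 * 2 ≤ c * c
    2*2≤c*c = *-mono-≤ 2≤c 2≤c

cofactor-mod-8 : ∀ c e w → c % 4 ≡ 3 → e * c % 8 ≡ (w * w + 1) % 8 → e % 4 ≡ 3 ⊎ e % 8 ≡ 6
cofactor-mod-8 c e w c≡3 eq = holds-by-residues (8 ∷ 8 ∷ 8 ∷ [])
  (vc ≡ con 3 mod 4 :∧ ve :* vc ≡ vw :* vw :+ con 1 mod 8 :⇒ ve ≡ con 3 mod 4 :∨ ve ≡ con 6 mod 8)
  (c ∷ e ∷ w ∷ []) (c≡3 , eq)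
  where
  vc ve vw : Expr 3
  vc = var zero
  ve = var (suc zero)
  vw = var (suc (suc zero))

smaller-cofactor : ∀ {c e} w → c % 4 ≡ 3 → w * w + 1 ≡ e * c →
                   ∃[ d ] (d ≤ e × d % 4 ≡ 3 × d ∣ w * w + 1)
smaller-cofactor {c} {e} w c≡3 eq with cofactor-mod-8 c e w c≡3 (cong (_% 8) (sym eq))
... | inj₁ e≡3 = e , ≤-refl , e≡3 , divides c (trans eq (*-comm e c))
... | inj₂ e≡6 = d , d≤e , [m+kn]%n≡m%n 3 (e / 8) 4 , divides (2 * c) (trans eq e*c≡2c*d)
  where
  d : ℕ
  d = 3 + e / 8 * 4
  e≡2d : e ≡ 2 * d
  e≡2d = trans (m≡m%n+[m/n]*n e 8) (trans (cong (_+ e / 8 * 8) e≡6) (halve (e / 8)))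
    where
    halve : ∀ k → 6 + k * 8 ≡ 2 * (3 + k * 4)
    halve = solve-∀
  d≤e : d ≤ e
  d≤e = ≤-trans (m≤m+n d (d + 0)) (≤-reflexive (sym e≡2d))
  e*c≡2c*d : e * c ≡ 2 * c * d
  e*c≡2c*d = trans (cong (_* c) e≡2d) (swap c d)
    where
    swap : ∀ c d → 2 * d * c ≡ 2 * c * d
    swap = solve-∀

-- Descent: c ∣ w² + 1 with 2w ≤ c gives w² + 1 = e c with e < c, and e or e / 2 is again ≡ 3 (mod 4).
3mod4-∤-square+1 : ∀ {c} z → c % 4 ≡ 3 → ¬ c ∣ z * z + 1
3mod4-∤-square+1 {c} = <-rec (λ c → ∀ z → c % 4 ≡ 3 → ¬ c ∣ z * z + 1) descend c
  where
  descend : ∀ c → (∀ {c′} → c′ < c → ∀ z → c′ % 4 ≡ 3 → ¬ c′ ∣ z * z + 1) →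
            ∀ z → c % 4 ≡ 3 → ¬ c ∣ z * z + 1
  descend zero      _       _ ()
  descend c@(suc _) smaller z c≡3 c∣
    with square+1-small-root z c∣
  ... | w , 2w≤c , divides e eq
    with smaller-cofactor {c} {e} w c≡3 eq
  ... | d , d≤e , d≡3 , d∣ =
    smaller (≤-<-trans d≤e (cofactor-< {c} {e} w 2≤c 2w≤c eq)) w d≡3 d∣
    where
    2≤c : 2 ≤ c
    2≤c = ≤-trans (n≤1+n 2) (subst (_≤ c) c≡3 (m%n≤m c 4))

coprime⇒square-root-of-1 : ∀ {y c} .{{_ : NonZero c}} → Coprime y c →
                           ∃[ a ] (a * y) * (a * y) % c ≡ 1 % c
coprime⇒square-root-of-1 {y} {c} y⊥c with coprime-Bézout y⊥c
... | Bézout.+- a k eq = a , (begin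
  a * y * (a * y) % c              ≡⟨ cong (λ t → t * t % c) eq ⟨
  (1 + k * c) * (1 + k * c) % c    ≡⟨ cong (_% c) (expand k c) ⟩
  (1 + (2 * k + k * k * c) * c) % c ≡⟨ [m+kn]%n≡m%n 1 (2 * k + k * k * c) c ⟩
  1 % c                            ∎)
  where
  open ≡-Reasoning
  expand : ∀ k c → (1 + k * c) * (1 + k * c) ≡ 1 + (2 * k + k * k * c) * c
  expand = solve-∀
... | Bézout.-+ a k eq = a , (begin
  a * y * (a * y) % c                     ≡⟨ [m+kn]%n≡m%n (a * y * (a * y)) (2 * k) c ⟨
  (a * y * (a * y) + 2 * k * c) % c       ≡⟨ cong (_% c) (square-of-1+ay (a * y) k c eq) ⟩
  (1 + k * k * c * c) % c                 ≡⟨ [m+kn]%n≡m%n 1 (k * k * c) c ⟩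
  1 % c                                   ∎)
  where
  open ≡-Reasoning
  square-of-1+ay : ∀ x k c → 1 + x ≡ k * c → x * x + 2 * k * c ≡ 1 + k * k * c * c
  square-of-1+ay x k c eq′ = begin
    x * x + 2 * k * c      ≡⟨ cong (x * x +_) (*-assoc 2 k c) ⟩
    x * x + 2 * (k * c)    ≡⟨ cong (λ t → x * x + 2 * t) eq′ ⟨
    x * x + 2 * (1 + x)    ≡⟨ complete-square x ⟩
    1 + (1 + x) * (1 + x)  ≡⟨ cong (λ t → 1 + t * t) eq′ ⟩
    1 + k * c * (k * c)    ≡⟨ cong (1 +_) (rearrange k c) ⟩
    1 + k * k * c * c      ∎
    where
    complete-square : ∀ x → x * x + 2 * (1 + x) ≡ 1 + (1 + x) * (1 + x)
    complete-square = solve-∀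
    rearrange : ∀ k c → k * c * (k * c) ≡ k * k * c * c
    rearrange = solve-∀

3mod4-∤-sum-of-squares : ∀ {c y} x → c % 4 ≡ 3 → Coprime y c → ¬ c ∣ x * x + y * y
3mod4-∤-sum-of-squares {zero}          x () 
3mod4-∤-sum-of-squares {c@(suc _)} {y} x c≡3 y⊥c c∣ with coprime⇒square-root-of-1 y⊥c
... | a , ay²≡1 = 3mod4-∤-square+1 (a * x) c≡3 (m%n≡0⇒n∣m _ c (begin
  (ax² + 1) % c                ≡⟨ %-cong-+ {a = ax²} {a′ = ax²} {b = 1} {b′ = ay²} refl (sym ay²≡1) ⟩
  (ax² + ay²) % c              ≡⟨ cong (_% c) (scale a x y) ⟩
  a * a * (x * x + y * y) % c  ≡⟨ n∣m⇒m%n≡0 _ c (∣n⇒∣m*n (a * a) c∣) ⟩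
  0                            ∎))
  where
  open ≡-Reasoning
  ax² ay² : ℕ
  ax² = a * x * (a * x)
  ay² = a * y * (a * y)
  scale : ∀ a x y → a * x * (a * x) + a * y * (a * y) ≡ a * a * (x * x + y * y)
  scale = solve-∀

-- Coprimality

¬∣⇒coprime : ∀ {p a} → Irreducible p → ¬ p ∣ a → Coprime a p
¬∣⇒coprime irr p∤a (i∣a , i∣p) with irr i∣p
... | inj₁ i≡1 = i≡1
... | inj₂ refl = contradiction i∣a p∤a

coprime-* : ∀ {a b c} → Coprime a b → Coprime a c → Coprime a (b * c)
coprime-* {b = b} a⊥b a⊥c {i} (i∣a , i∣bc) = a⊥c (i∣a , coprime-divisor i⊥b i∣bc)
  where
  i⊥b : Coprime i b
  i⊥b (j∣i , j∣b) = a⊥b (∣-trans j∣i i∣a , j∣b)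

coprime-+-* : ∀ {a b} k → Coprime a b → Coprime a (b + k * a)
coprime-+-* {a} {b} k a⊥b {i} (i∣a , i∣b+ka) =
  a⊥b (i∣a , ∣m+n∣m⇒∣n (subst (i ∣_) (+-comm b (k * a)) i∣b+ka) (∣n⇒∣m*n k i∣a))

∣⇒coprime-+ : ∀ {a b c} → Coprime a b → c ∣ b → Coprime c (a + b)
∣⇒coprime-+ {a} {b} a⊥b c∣b {i} (i∣c , i∣a+b) =
  a⊥b (∣m+n∣m⇒∣n (subst (i ∣_) (+-comm a b) i∣a+b) i∣b , i∣b)
  where
  i∣b : i ∣ b
  i∣b = ∣-trans i∣c c∣b

coprime⇒¬both-%≡0 : ∀ {a b} → Coprime a b → ∀ p .{{_ : NonZero p}} → p ≢ 1 →
                    ¬ (a % p ≡ 0 × b % p ≡ 0)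
coprime⇒¬both-%≡0 {a} {b} a⊥b p p≢1 (a≡0 , b≡0) =
  p≢1 (a⊥b (m%n≡0⇒n∣m a p a≡0 , m%n≡0⇒n∣m b p b≡0))

%3≢0⇒coprime-3 : ∀ {a} → ¬ a % 3 ≡ 0 → Coprime a 3
%3≢0⇒coprime-3 {a} a≢0 = ¬∣⇒coprime (from-yes (irreducible? 3)) (a≢0 ∘ n∣m⇒m%n≡0 a 3)

vη vδ vf vM : Expr 4
vη = var zero
vδ = var (suc zero)
vf = var (suc (suc zero))
vM = var (suc (suc (suc zero)))

-- The second variable, in environments η ∷ d ∷ f ∷ M ∷ [] where δ = 3 * d.
vd : Expr 4
vd = vδ

%3≡0⇒≡3* : ∀ {δ} → δ % 3 ≡ 0 → ∃[ d ] δ ≡ 3 * d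
%3≡0⇒≡3* {δ} δ≡0 with m%n≡0⇒n∣m δ 3 δ≡0
... | divides d eq = d , trans eq (*-comm d 3)

Equation : ℕ → ℕ → ℕ → ℕ → Set
Equation η δ f M = 3 * (δ * f) ^ 2 ≡ 3 * (M * (η + δ) ^ 2) + δ ^ 2 * (M + 1)

equation-as-products : ∀ {η δ f M} → Equation η δ f M →
                       3 * (δ * f * (δ * f)) ≡ 3 * (M * ((η + δ) * (η + δ))) + δ * δ * (M + 1)
equation-as-products {η} {δ} {f} {M} E = begin
  3 * (δ * f * (δ * f))                              ≡⟨ cong (3 *_) (m^2≡m*m (δ * f)) ⟨
  3 * (δ * f) ^ 2                                    ≡⟨ E ⟩
  3 * (M * (η + δ) ^ 2) + δ ^ 2 * (M + 1)
    ≡⟨ cong₂ (λ x y → 3 * (M * x) + y * (M + 1)) (m^2≡m*m (η + δ)) (m^2≡m*m δ) ⟩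
  3 * (M * ((η + δ) * (η + δ))) + δ * δ * (M + 1)    ∎
  where open ≡-Reasoning

equation-divided-by-3 : ∀ {η d f M} → Equation η (3 * d) f M →
                        9 * (d * f * (d * f)) ≡ M * ((η + 3 * d) * (η + 3 * d)) + 3 * (d * d) * (M + 1)
equation-divided-by-3 {η} {d} {f} {M} E = *-cancelˡ-≡ _ _ 3 (begin
  3 * (9 * (d * f * (d * f)))                                  ≡⟨ lhs d f ⟩
  3 * (3 * d * f * (3 * d * f))                                ≡⟨ equation-as-products {η} {3 * d} {f} {M} E ⟩
  3 * (M * ((η + 3 * d) * (η + 3 * d))) + 3 * d * (3 * d) * (M + 1) ≡⟨ rhs η d M ⟩
  3 * (M * ((η + 3 * d) * (η + 3 * d)) + 3 * (d * d) * (M + 1)) ∎)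
  where
  open ≡-Reasoning
  lhs : ∀ d f → 3 * (9 * (d * f * (d * f))) ≡ 3 * (3 * d * f * (3 * d * f))
  lhs = solve-∀
  rhs : ∀ η d M → 3 * (M * ((η + 3 * d) * (η + 3 * d))) + 3 * d * (3 * d) * (M + 1)
                ≡ 3 * (M * ((η + 3 * d) * (η + 3 * d)) + 3 * (d * d) * (M + 1))
  rhs = solve-∀

m*c+s≡k*c⇒c∣s : ∀ {c s} m k → m * c + s ≡ k * c → c ∣ s
m*c+s≡k*c⇒c∣s {c} m k eq = ∣m+n∣m⇒∣n (subst (c ∣_) (sym eq) (n∣m*n k)) (n∣m*n m)

2∣δ⇒3∣δ : ∀ {η δ f M} → Coprime η δ → Equation η δ f M → δ % 2 ≡ 0 → δ % 3 ≡ 0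
2∣δ⇒3∣δ {η} {δ} {f} {M} η⊥δ E δ≡0 with δ % 3 ≟ 0
... | yes δ≡0[3] = δ≡0[3]
... | no  δ≢0[3] =
  ⊥-elim (3mod4-∤-sum-of-squares (3 * u * f) c≡3 δ⊥c (m*c+s≡k*c⇒c∣s M (3 * (f * f)) identity))
  where
  u c : ℕ
  u = η + δ
  c = 3 * (u * u) + δ * δ
  c≡3 : c % 4 ≡ 3
  c≡3 = holds-by-residues (4 ∷ 4 ∷ 1 ∷ 1 ∷ [])
    (:¬ (vη ≡ con 0 mod 2 :∧ vδ ≡ con 0 mod 2) :∧ vδ ≡ con 0 mod 2
      :⇒ con 3 :* ((vη :+ vδ) :* (vη :+ vδ)) :+ vδ :* vδ ≡ con 3 mod 4)
    (η ∷ δ ∷ f ∷ M ∷ []) (coprime⇒¬both-%≡0 η⊥δ 2 (λ ()) , δ≡0)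
  δ⊥u : Coprime δ u
  δ⊥u = ∣⇒coprime-+ η⊥δ ∣-refl
  δ⊥c : Coprime δ c
  δ⊥c = coprime-+-* δ (coprime-* (%3≢0⇒coprime-3 δ≢0[3]) (coprime-* δ⊥u δ⊥u))
  identity : M * c + (3 * u * f * (3 * u * f) + δ * δ) ≡ 3 * (f * f) * c
  identity = begin
    M * c + (3 * u * f * (3 * u * f) + δ * δ)                  ≡⟨ regroup u δ f M ⟩
    3 * (f * f) * (3 * (u * u)) + (3 * (M * (u * u)) + δ * δ * (M + 1))
      ≡⟨ cong (3 * (f * f) * (3 * (u * u)) +_) (equation-as-products {η} {δ} {f} {M} E) ⟨
    3 * (f * f) * (3 * (u * u)) + 3 * (δ * f * (δ * f))       ≡⟨ factor u δ f ⟩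
    3 * (f * f) * c                                            ∎
    where
    open ≡-Reasoning
    regroup : ∀ u δ f M → M * (3 * (u * u) + δ * δ) + (3 * u * f * (3 * u * f) + δ * δ)
                        ≡ 3 * (f * f) * (3 * (u * u)) + (3 * (M * (u * u)) + δ * δ * (M + 1))
    regroup = solve-∀
    factor : ∀ u δ f → 3 * (f * f) * (3 * (u * u)) + 3 * (δ * f * (δ * f))
                     ≡ 3 * (f * f) * (3 * (u * u) + δ * δ)
    factor = solve-∀

2∤δ⇒3∤δ : ∀ {η δ f M} → Coprime η δ → Equation η δ f M →
          η % 2 ≡ 1 → δ % 2 ≡ 1 → ¬ δ % 3 ≡ 0
2∤δ⇒3∤δ {η} {δ} {f} {M} η⊥δ E η≡1 δ≡1 δ≡0[3] with %3≡0⇒≡3* {δ} δ≡0[3]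
... | d , refl = 3mod4-∤-sum-of-squares (u * f) w≡3 d⊥w
                   (coprime-divisor (%3≢0⇒coprime-3 w≢0[3])
                     (m*c+s≡k*c⇒c∣s M (3 * (f * f)) identity))
  where
  u w : ℕ
  u = η + 3 * d
  w = u * u + 3 * d * d
  residues : w % 4 ≡ 3 × ¬ w % 3 ≡ 0
  residues = holds-by-residues (12 ∷ 12 ∷ 1 ∷ 1 ∷ [])
    (vη ≡ con 1 mod 2 :∧ con 3 :* vd ≡ con 1 mod 2 :∧ :¬ (vη ≡ con 0 mod 3)
      :⇒ wᵉ ≡ con 3 mod 4 :∧ :¬ (wᵉ ≡ con 0 mod 3))
    (η ∷ d ∷ f ∷ M ∷ [])
    (η≡1 , δ≡1 , λ η≡0 → coprime⇒¬both-%≡0 η⊥δ 3 (λ ()) (η≡0 , δ≡0[3]))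
    where
    wᵉ : Expr 4
    wᵉ = (vη :+ con 3 :* vd) :* (vη :+ con 3 :* vd) :+ con 3 :* vd :* vd
  w≡3 : w % 4 ≡ 3
  w≡3 = proj₁ residues
  w≢0[3] : ¬ w % 3 ≡ 0
  w≢0[3] = proj₂ residues
  d⊥u : Coprime d u
  d⊥u = ∣⇒coprime-+ η⊥δ (n∣m*n 3)
  d⊥w : Coprime d w
  d⊥w = coprime-+-* (3 * d) (coprime-* d⊥u d⊥u)
  identity : M * w + 3 * (u * f * (u * f) + d * d) ≡ 3 * (f * f) * w
  identity = begin
    M * w + 3 * (u * f * (u * f) + d * d)                        ≡⟨ regroup u d f M ⟩
    M * (u * u) + 3 * (d * d) * (M + 1) + 3 * (u * u) * (f * f)
      ≡⟨ cong (_+ 3 * (u * u) * (f * f)) (equation-divided-by-3 {η} {d} {f} {M} E) ⟨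
    9 * (d * f * (d * f)) + 3 * (u * u) * (f * f)                ≡⟨ factor u d f ⟩
    3 * (f * f) * w                                              ∎
    where
    open ≡-Reasoning
    regroup : ∀ u d f M → M * (u * u + 3 * d * d) + 3 * (u * f * (u * f) + d * d)
                        ≡ M * (u * u) + 3 * (d * d) * (M + 1) + 3 * (u * u) * (f * f)
    regroup = solve-∀
    factor : ∀ u d f → 9 * (d * f * (d * f)) + 3 * (u * u) * (f * f) ≡ 3 * (f * f) * (u * u + 3 * d * d)
    factor = solve-∀

equation-mod : (m : ℕ) .{{_ : NonZero m}} → Formula 4
equation-mod m = con 3 :* (vδ :* vf :* (vδ :* vf))
               ≡ con 3 :* (vM :* ((vη :+ vδ) :* (vη :+ vδ))) :+ vδ :* vδ :* (vM :+ con 1) mod m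

TwoAdic : Formula 4
TwoAdic = vη ≡ con 1 mod 2
  :∧ (vδ ≡ con 1 mod 2
       :⇒ (vf ≡ con 1 mod 2 :⇒ vM ≡ con 2 mod 8) :∧ (vf ≡ con 0 mod 2 :⇒ vM ≡ con 3 mod 4))
  :∧ (vδ ≡ con 0 mod 4 :⇒ vM ≡ con 0 mod 16)
  :∧ (vδ ≡ con 2 mod 4
       :⇒ (vf ≡ con 1 mod 2 :⇒ vM ≡ con 8 mod 16) :∧ (vf ≡ con 0 mod 2 :⇒ vM ≡ con 4 mod 8))

-- When 3 ∤ δ the equation gives M ≡ 3f² + 3(ηδ + 1)² + 8 (mod 9).
ThreeAdic-3∤δ : Formula 4
ThreeAdic-3∤δ = :¬ (vδ ≡ con 0 mod 3) :⇒
     (vf ≡ con 0 mod 3 :∧ vη :* vδ ≡ con 2 mod 3 :⇒ vM ≡ con 8 mod 9)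
  :∧ (vf ≡ con 0 mod 3 :∧ :¬ (vη :* vδ ≡ con 2 mod 3) :⇒ vM ≡ con 2 mod 9)
  :∧ (:¬ (vf ≡ con 0 mod 3) :∧ vη :* vδ ≡ con 2 mod 3 :⇒ vM ≡ con 2 mod 9)
  :∧ (:¬ (vf ≡ con 0 mod 3) :∧ :¬ (vη :* vδ ≡ con 2 mod 3) :⇒ vM ≡ con 5 mod 9)

ThreeAdic-3∣δ : Formula 4
ThreeAdic-3∣δ = vδ ≡ con 0 mod 3 :⇒
     (vδ ≡ con 0 mod 9 :⇒ vM ≡ con 0 mod 9)
  :∧ (:¬ (vδ ≡ con 0 mod 9) :⇒ vM ≡ con 6 mod 9)

equation⇒TwoAdic : ∀ {η δ f M} → Coprime η δ → Equation η δ f M →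
                   Holds TwoAdic (η ∷ δ ∷ f ∷ M ∷ [])
equation⇒TwoAdic {η} {δ} {f} {M} η⊥δ E = holds-by-residues (16 ∷ 16 ∷ 16 ∷ 16 ∷ [])
  (:¬ (vη ≡ con 0 mod 2 :∧ vδ ≡ con 0 mod 2) :∧ equation-mod 16 :⇒ TwoAdic)
  (η ∷ δ ∷ f ∷ M ∷ [])
  (coprime⇒¬both-%≡0 η⊥δ 2 (λ ()) , cong (_% 16) (equation-as-products {η} {δ} {f} {M} E))

equation⇒ThreeAdic-3∤δ : ∀ {η δ f M} → Equation η δ f M →
                         Holds ThreeAdic-3∤δ (η ∷ δ ∷ f ∷ M ∷ [])
equation⇒ThreeAdic-3∤δ {η} {δ} {f} {M} E = holds-by-residues (9 ∷ 9 ∷ 9 ∷ 9 ∷ [])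
  (equation-mod 9 :⇒ ThreeAdic-3∤δ)
  (η ∷ δ ∷ f ∷ M ∷ [])
  (cong (_% 9) (equation-as-products {η} {δ} {f} {M} E))

-- For δ = 3d the equation modulo 9 only gives 3 ∣ M, so its quotient by 3 is read modulo 9 instead.
equation⇒ThreeAdic-3∣δ : ∀ {η δ f M} → Coprime η δ → Equation η δ f M →
                         Holds ThreeAdic-3∣δ (η ∷ δ ∷ f ∷ M ∷ [])
equation⇒ThreeAdic-3∣δ {η} {δ} {f} {M} η⊥δ E δ≡0[3] with %3≡0⇒≡3* {δ} δ≡0[3]
... | d , refl = holds-by-residues (9 ∷ 9 ∷ 9 ∷ 9 ∷ [])
  (:¬ (vη ≡ con 0 mod 3) :∧ divided-equation-mod-9
    :⇒ (con 3 :* vd ≡ con 0 mod 9 :⇒ vM ≡ con 0 mod 9)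
    :∧ (:¬ (con 3 :* vd ≡ con 0 mod 9) :⇒ vM ≡ con 6 mod 9))
  (η ∷ d ∷ f ∷ M ∷ [])
  ( (λ η≡0 → coprime⇒¬both-%≡0 η⊥δ 3 (λ ()) (η≡0 , δ≡0[3]))
  , cong (_% 9) (equation-divided-by-3 {η} {d} {f} {M} E) )
  where
  divided-equation-mod-9 : Formula 4
  divided-equation-mod-9 = con 9 :* (vd :* vf :* (vd :* vf))
    ≡ vM :* ((vη :+ con 3 :* vd) :* (vη :+ con 3 :* vd)) :+ con 3 :* (vd :* vd) :* (vM :+ con 1) mod 9

η≡ : ℕ → Formula 4
η≡ k = vη ≡ con k mod 6

Table : Formula 4
Table = (vη ≡ con 1 mod 2)
  :∧ (vδ ≡ con 0 mod 6 :∨ vδ ≡ con 1 mod 6 :∨ vδ ≡ con 5 mod 6)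
  :∧ (vδ ≡ con 0 mod 6 :⇒ vM ≡ con 0 mod 12)
  :∧ ((vδ ≡ con 1 mod 6 :∨ vδ ≡ con 5 mod 6)
       :⇒ (vf ≡ con 1 mod 2 :⇒ vM ≡ con 2 mod 12) :∧ (vf ≡ con 0 mod 2 :⇒ vM ≡ con 11 mod 12))
  :∧ ( (vδ ≡ con 0 mod 36 :∧ (η≡ 1 :∨ η≡ 5) :∧ vM ≡ con 0 mod 144)
     :∨ ((vδ ≡ con 12 mod 36 :∨ vδ ≡ con 24 mod 36) :∧ (η≡ 1 :∨ η≡ 5) :∧ vM ≡ con 96 mod 144)
     :∨ ((vδ ≡ con 6 mod 36 :∨ vδ ≡ con 30 mod 36) :∧ (η≡ 1 :∨ η≡ 5) :∧ vf ≡ con 1 mod 2 :∧ vM ≡ con 24 mod 144)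
     :∨ (vδ ≡ con 18 mod 36 :∧ (η≡ 1 :∨ η≡ 5) :∧ vf ≡ con 1 mod 2 :∧ vM ≡ con 72 mod 144)
     :∨ (vδ ≡ con 1 mod 6
        :∧ ((vf ≡ con 1 mod 6 :∨ vf ≡ con 5 mod 6)
           :⇒ ((η≡ 1 :∨ η≡ 3) :⇒ vM ≡ con 50 mod 72) :∧ (η≡ 5 :⇒ vM ≡ con 2 mod 72))
        :∧ (vf ≡ con 3 mod 6
           :⇒ ((η≡ 1 :∨ η≡ 3) :⇒ vM ≡ con 2 mod 72) :∧ (η≡ 5 :⇒ vM ≡ con 26 mod 72))
        :∧ (vf ≡ con 0 mod 6
           :⇒ ((η≡ 1 :∨ η≡ 3) :⇒ vM ≡ con 11 mod 36) :∧ (η≡ 5 :⇒ vM ≡ con 35 mod 36))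
        :∧ ((vf ≡ con 2 mod 6 :∨ vf ≡ con 4 mod 6)
           :⇒ ((η≡ 1 :∨ η≡ 3) :⇒ vM ≡ con 23 mod 36) :∧ (η≡ 5 :⇒ vM ≡ con 11 mod 36)))
     :∨ (vδ ≡ con 5 mod 6
        :∧ ((vf ≡ con 1 mod 6 :∨ vf ≡ con 5 mod 6)
           :⇒ (η≡ 1 :⇒ vM ≡ con 2 mod 72) :∧ ((η≡ 3 :∨ η≡ 5) :⇒ vM ≡ con 50 mod 72))
        :∧ (vf ≡ con 3 mod 6
           :⇒ (η≡ 1 :⇒ vM ≡ con 26 mod 72) :∧ ((η≡ 3 :∨ η≡ 5) :⇒ vM ≡ con 2 mod 72))
        :∧ (vf ≡ con 0 mod 6
           :⇒ (η≡ 1 :⇒ vM ≡ con 35 mod 36) :∧ ((η≡ 3 :∨ η≡ 5) :⇒ vM ≡ con 11 mod 36))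
        :∧ ((vf ≡ con 2 mod 6 :∨ vf ≡ con 4 mod 6)
           :⇒ (η≡ 1 :⇒ vM ≡ con 11 mod 36) :∧ ((η≡ 3 :∨ η≡ 5) :⇒ vM ≡ con 23 mod 36))) )

LocalConstraints : Formula 4
LocalConstraints = :¬ (vη ≡ con 0 mod 3 :∧ vδ ≡ con 0 mod 3)
  :∧ TwoAdic :∧ ThreeAdic-3∤δ :∧ ThreeAdic-3∣δ
  :∧ (vδ ≡ con 0 mod 2 :⇒ vδ ≡ con 0 mod 3) :∧ (vδ ≡ con 1 mod 2 :⇒ :¬ (vδ ≡ con 0 mod 3))
  :∧ :¬ (vM ≡ con 4 mod 8)

theorem1 : (η δ M f : ℕ) → 1 < η → 1 < δ → 1 < M → 1 ≤ f → gcd η δ ≡ 1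
  → (∃[ a ] ∃[ s ] (1 ≤ a × sumSq a M ≡ s ^ 2))
  → 3 * (δ * f) ^ 2 ≡ 3 * (M * (η + δ) ^ 2) + δ ^ 2 * (M + 1)
  → (η % 2 ≡ 1)
    × (δ % 6 ≡ 0 ⊎ δ % 6 ≡ 1 ⊎ δ % 6 ≡ 5)
    × (δ % 6 ≡ 0 → M % 12 ≡ 0)
    × ((δ % 6 ≡ 1 ⊎ δ % 6 ≡ 5) → (f % 2 ≡ 1 → M % 12 ≡ 2) × (f % 2 ≡ 0 → M % 12 ≡ 11))
    × ( (δ % 36 ≡ 0 × (η % 6 ≡ 1 ⊎ η % 6 ≡ 5) × M % 144 ≡ 0)
      ⊎ ((δ % 36 ≡ 12 ⊎ δ % 36 ≡ 24) × (η % 6 ≡ 1 ⊎ η % 6 ≡ 5) × M % 144 ≡ 96)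
      ⊎ ((δ % 36 ≡ 6 ⊎ δ % 36 ≡ 30) × (η % 6 ≡ 1 ⊎ η % 6 ≡ 5) × f % 2 ≡ 1 × M % 144 ≡ 24)
      ⊎ (δ % 36 ≡ 18 × (η % 6 ≡ 1 ⊎ η % 6 ≡ 5) × f % 2 ≡ 1 × M % 144 ≡ 72)
      ⊎ (δ % 6 ≡ 1
         × ((f % 6 ≡ 1 ⊎ f % 6 ≡ 5)
            → ((η % 6 ≡ 1 ⊎ η % 6 ≡ 3) → M % 72 ≡ 50) × (η % 6 ≡ 5 → M % 72 ≡ 2))
         × (f % 6 ≡ 3
            → ((η % 6 ≡ 1 ⊎ η % 6 ≡ 3) → M % 72 ≡ 2) × (η % 6 ≡ 5 → M % 72 ≡ 26))
         × (f % 6 ≡ 0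
            → ((η % 6 ≡ 1 ⊎ η % 6 ≡ 3) → M % 36 ≡ 11) × (η % 6 ≡ 5 → M % 36 ≡ 35))
         × ((f % 6 ≡ 2 ⊎ f % 6 ≡ 4)
            → ((η % 6 ≡ 1 ⊎ η % 6 ≡ 3) → M % 36 ≡ 23) × (η % 6 ≡ 5 → M % 36 ≡ 11)))
      ⊎ (δ % 6 ≡ 5
         × ((f % 6 ≡ 1 ⊎ f % 6 ≡ 5)
            → (η % 6 ≡ 1 → M % 72 ≡ 2) × ((η % 6 ≡ 3 ⊎ η % 6 ≡ 5) → M % 72 ≡ 50))
         × (f % 6 ≡ 3
            → (η % 6 ≡ 1 → M % 72 ≡ 26) × ((η % 6 ≡ 3 ⊎ η % 6 ≡ 5) → M % 72 ≡ 2))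
         × (f % 6 ≡ 0
            → (η % 6 ≡ 1 → M % 36 ≡ 35) × ((η % 6 ≡ 3 ⊎ η % 6 ≡ 5) → M % 36 ≡ 11))
         × ((f % 6 ≡ 2 ⊎ f % 6 ≡ 4)
            → (η % 6 ≡ 1 → M % 36 ≡ 11) × ((η % 6 ≡ 3 ⊎ η % 6 ≡ 5) → M % 36 ≡ 23))) )
theorem1 η δ M f _ _ _ _ gcd≡1 (a , s , _ , sq) E =
  holds-by-residues (6 ∷ 36 ∷ 6 ∷ 144 ∷ []) (LocalConstraints :⇒ Table) (η ∷ δ ∷ f ∷ M ∷ [])
    ( coprime⇒¬both-%≡0 η⊥δ 3 (λ ())
    , two-adic
    , equation⇒ThreeAdic-3∤δ {η} {δ} {f} {M} E
    , equation⇒ThreeAdic-3∣δ η⊥δ E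
    , 2∣δ⇒3∣δ η⊥δ E
    , 2∤δ⇒3∤δ η⊥δ E (proj₁ two-adic)
    , sumSq≡square⇒%8≢4 {a} {M} {s} sq )
  where
  η⊥δ : Coprime η δ
  η⊥δ = gcd≡1⇒coprime gcd≡1
  two-adic : Holds TwoAdic (η ∷ δ ∷ f ∷ M ∷ [])
  two-adic = equation⇒TwoAdic η⊥δ E
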